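{- For every integer $r\geq 1$, the $r$-dimensional Benes network $BN(r)$ satisfies ${\rm ip}_{c}(BN(r))={\rm ip}_{p}(BN(r))=2^r$.
   Context: The $r$-dimensional Benes network $BN(r)$ (two $r$-dimensional butterflies placed back to back, sharing their level-$r$ vertices) has vertex set $\{\langle w,i\rangle : w\in\{0,1\}^r,\ 0\le i\le 2r\}$, where $w=w_0w_1\cdots w_{r-1}$. For $0\le i<r$, $\langle w,i\rangle$ is adjacent to $\langle w',i+1\rangle$ iff $w=w'$ or $w,w'$ differ exactly in bit position $i$; for $r\le i<2r$, $\langle w,i\rangle$ is adjacent to $\langle w',i+1\rangle$ iff $w=w'$ or $w,w'$ differ exactly in bit position $2r-1-i$; there are no other edges. A path is isometric if its length equals the distance between its endpoints; single vertices count as paths. ${\rm ip}_{c}(H)$ (resp. ${\rm ip}_{p}(H)$) is the minimum number of isometric paths of $H$ whose vertex sets cover (resp. partition) $V(H)$. -}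

module Defs where

open import Data.Nat using (ℕ; zero; suc; _+_; _*_; _∸_; _≤_; _<_; _<?_)
open import Relation.Nullary using (yes; no)
open import Data.Bool using (Bool)
open import Data.Fin using (Fin; toℕ)
open import Data.Vec using (Vec; lookup)
open import Data.List using (List; _∷_)
open import Data.List.NonEmpty as L⁺ using (List⁺; _∷_; toList)
open import Data.List.Relation.Unary.Linked using (Linked)
open import Data.List.Relation.Unary.Unique.Propositional using (Unique)
open import Data.List.Membership.Propositional using (_∈_)
open import Data.Product using (Σ; _×_; _,_)
open import Data.Sum using (_⊎_)
open import Relation.Binary.PropositionalEquality using (_≡_; _≢_)

-- Generic graph notions, for a graph given by a vertex type V and an
-- adjacency relation Adj (assumed symmetric by the user).

module GraphNotions (V : Set) (Adj : V → V → Set) where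

  data Walk : V → V → ℕ → Set where
    here : ∀ {v} → Walk v v 0
    step : ∀ {u w v n} → Adj u w → Walk w v n → Walk u v (suc n)

  IsDist : V → V → ℕ → Set
  IsDist u v d = Walk u v d × (∀ n → Walk u v n → d ≤ n)

  IsPath : List⁺ V → Set
  IsPath P = Unique (toList P) × Linked Adj (toList P)

  pathLength : List⁺ V → ℕ
  pathLength P = L⁺.length P ∸ 1

  IsIsometricPath : List⁺ V → Set
  IsIsometricPath P = IsPath P × IsDist (L⁺.head P) (L⁺.last P) (pathLength P)

  HasIsoPathCover : ℕ → Set
  HasIsoPathCover k =
    Σ (Fin k → List⁺ V) λ P →
      (∀ i → IsIsometricPath (P i)) ×
      (∀ v → Σ (Fin k) λ i → v ∈ toList (P i))

  HasIsoPathPartition : ℕ → Set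
  HasIsoPathPartition k =
    Σ (Fin k → List⁺ V) λ P →
      (∀ i → IsIsometricPath (P i)) ×
      (∀ v → Σ (Fin k) λ i → v ∈ toList (P i) × (∀ j → v ∈ toList (P j) → j ≡ i))

  IpCoverIs : ℕ → Set
  IpCoverIs k = HasIsoPathCover k × (∀ m → HasIsoPathCover m → k ≤ m)

  IpPartitionIs : ℕ → Set
  IpPartitionIs k = HasIsoPathPartition k × (∀ m → HasIsoPathPartition m → k ≤ m)

BNVertex : ℕ → Set
BNVertex r = Vec Bool r × Fin (suc (2 * r))

DiffExactlyAt : ∀ {r} → Vec Bool r → Vec Bool r → ℕ → Set
DiffExactlyAt {r} w w' p =
  ∀ (q : Fin r) → (toℕ q ≡ p → lookup w q ≢ lookup w' q)
                × (toℕ q ≢ p → lookup w q ≡ lookup w' q)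

-- bit position used between levels i and i+1
bitPos : ℕ → ℕ → ℕ
bitPos r i with i <? r
... | yes _ = i
... | no _  = 2 * r ∸ suc i

BNEdge : ∀ r → BNVertex r → BNVertex r → Set
BNEdge r (w , i) (w' , j) =
  toℕ j ≡ suc (toℕ i) × (w ≡ w' ⊎ DiffExactlyAt w w' (bitPos r (toℕ i)))

BNAdj : ∀ r → BNVertex r → BNVertex r → Set
BNAdj r u v = BNEdge r u v ⊎ BNEdge r v u

module Submission where

-- The 2^r lines {⟨w,i⟩ : 0 ≤ i ≤ 2r} partition the vertices, and each is isometric because
-- an edge changes the level by at most one. Conversely BN(r) has diameter at most 2r: along
-- the r levels of either butterfly every bit can be set freely, so one can move vertically to
-- level 0 (resp. r), cross the lower (resp. upper) butterfly while rewriting the word, and move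
-- vertically to the target; for i ≤ j one of these two routes has length at most 2r. Hence an
-- isometric path has at most 2r + 1 vertices, and covering all 2^r (2r + 1) vertices takes at
-- least 2^r of them.

open import Defs
open import Data.Bool using (Bool; if_then_else_)
import Data.Bool
open import Data.Fin using (Fin; toℕ; fromℕ; fromℕ<; inject₁; combine; remQuot)
  renaming (zero to fzero; suc to fsuc)
open import Data.Fin.Properties
  using (toℕ-injective; toℕ<n; toℕ-fromℕ; toℕ-fromℕ<; toℕ-inject₁;
         combine-remQuot; remQuot-combine; injective⇒≤; 2↔Bool; *↔×)
open import Data.List as List using (List; length; drop)
open import Data.List.NonEmpty as List⁺ using (List⁺; _∷_; toList)
open import Data.List.Membership.Propositional using (_∈_)
open import Data.List.Membership.Propositional.Properties using (∈-tabulate⁺; ∈-tabulate⁻)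
open import Data.List.Properties using (length-tabulate)
open import Data.List.Relation.Unary.Any as Any using (index)
open import Data.List.Relation.Unary.Linked using (Linked; [-]; _∷_)
open import Data.List.Relation.Unary.Unique.Propositional.Properties using (tabulate⁺)
open import Data.Maybe using (Maybe; just)
open import Data.Maybe.Properties using (just-injective)
open import Data.Nat
open import Data.Nat.Properties
open import Algebra.Properties.CommutativeSemigroup +-commutativeSemigroup
  using (x∙yz≈y∙xz; interchange)
open import Data.Product using (Σ; _×_; _,_; proj₁; proj₂)
open import Data.Product.Function.NonDependent.Propositional using (_×-↔_)
open import Data.Sum using (_⊎_; inj₁; inj₂; [_,_]′)
open import Data.Vec using (Vec; []; _∷_; lookup; tabulate)
open import Data.Vec.Properties using (≡-dec; lookup∘tabulate; tabulate∘lookup; tabulate-cong)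
open import Function using (_∘_; Injective)
open import Function.Bundles using (Inverse; Injection; _↔_; _↣_; mk↔ₛ′)
open import Function.Construct.Composition using (_↔-∘_)
open import Function.Construct.Identity using (↔-id)
open import Function.Properties.Inverse using (↔⇒↣)
open import Level using (0ℓ)
open import Relation.Binary using (Rel; Symmetric)
open import Relation.Binary.PropositionalEquality
open import Relation.Nullary using (¬_; Dec; yes; no; does; contradiction)
open import Relation.Nullary.Decidable using (dec-true; dec-false)

module _ {A : Set} where

  head-drop-index : ∀ {x : A} {xs} (x∈xs : x ∈ xs) →
                    List.head (drop (toℕ (index x∈xs)) xs) ≡ just x
  head-drop-index (Any.here refl) = refl
  head-drop-index (Any.there x∈xs) = head-drop-index x∈xs

  cover-by-short-lists⇒≤ : ∀ {n m K} → Fin n ↣ A →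
                           (P : Fin m → List A) → (∀ i → length (P i) ≤ K) →
                           (∀ x → Σ (Fin m) λ i → x ∈ P i) → n ≤ m * K
  cover-by-short-lists⇒≤ {n} {m} {K} Fin-n↣A P short cover = injective⇒≤ slot-injective
    where
    open Injection Fin-n↣A using () renaming (to to f; injective to f-injective)

    index<K : ∀ {i x} (x∈Pi : x ∈ P i) → toℕ (index x∈Pi) < K
    index<K {i} x∈Pi = <-≤-trans (toℕ<n (index x∈Pi)) (short i)

    position : ∀ {i x} → x ∈ P i → Fin K
    position x∈Pi = fromℕ< (index<K x∈Pi)

    slot : Fin n → Fin (m * K)
    slot k = combine (proj₁ (cover (f k))) (position (proj₂ (cover (f k))))

    fetch : Fin m × Fin K → Maybe A
    fetch (i , j) = List.head (drop (toℕ j) (P i))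

    read : Fin (m * K) → Maybe A
    read s = fetch (remQuot {m} K s)

    read-position : ∀ {i x} (x∈Pi : x ∈ P i) → read (combine i (position x∈Pi)) ≡ just x
    read-position {i} {x} x∈Pi = begin
      fetch (remQuot {m} K (combine i (position x∈Pi)))
        ≡⟨ cong fetch (remQuot-combine i (position x∈Pi)) ⟩
      List.head (drop (toℕ (position x∈Pi)) (P i))
        ≡⟨ cong (λ l → List.head (drop l (P i))) (toℕ-fromℕ< (index<K x∈Pi)) ⟩
      List.head (drop (toℕ (index x∈Pi)) (P i))
        ≡⟨ head-drop-index x∈Pi ⟩
      just x
        ∎
      where open ≡-Reasoning

    slot-injective : Injective _≡_ _≡_ slot
    slot-injective {k} {k′} eq = f-injective (just-injective (begin
      just (f k)      ≡⟨ read-position (proj₂ (cover (f k))) ⟨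
      read (slot k)   ≡⟨ cong read eq ⟩
      read (slot k′)  ≡⟨ read-position (proj₂ (cover (f k′))) ⟩
      just (f k′)     ∎))
      where open ≡-Reasoning

  linked-tabulate : ∀ {R : Rel A 0ℓ} n (g : Fin (suc n) → A) →
                    (∀ l → R (g (inject₁ l)) (g (fsuc l))) → Linked R (List.tabulate g)
  linked-tabulate zero    g R-step = [-]
  linked-tabulate (suc n) g R-step = R-step fzero ∷ linked-tabulate n (g ∘ fsuc) (R-step ∘ fsuc)

  last-∷ : ∀ (x y : A) ys → List⁺.last (x ∷ y List.∷ ys) ≡ List⁺.last (y ∷ ys)
  last-∷ x y ys with List.initLast ys
  ... | List.[]       = refl
  ... | _ List.∷ʳ′ _  = refl

  last-tabulate : ∀ n (g : Fin (suc n) → A) →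
                  List⁺.last (g fzero ∷ List.tabulate (g ∘ fsuc)) ≡ g (fromℕ n)
  last-tabulate zero    g = refl
  last-tabulate (suc n) g =
    trans (last-∷ (g fzero) (g (fsuc fzero)) (List.tabulate (g ∘ fsuc ∘ fsuc))) (last-tabulate n (g ∘ fsuc))

module WalkProperties (V : Set) (Adj : Rel V 0ℓ) (Adj-sym : Symmetric Adj) where
  open GraphNotions V Adj

  _++ʷ_ : ∀ {u v w m n} → Walk u v m → Walk v w n → Walk u w (m + n)
  here     ++ʷ q = q
  step a p ++ʷ q = step a (p ++ʷ q)

  _∷ʳʷ_ : ∀ {u v w n} → Walk u v n → Adj v w → Walk u w (suc n)
  here     ∷ʳʷ a = step a here
  step b p ∷ʳʷ a = step b (p ∷ʳʷ a)

  reverseʷ : ∀ {u v n} → Walk u v n → Walk v u n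
  reverseʷ here       = here
  reverseʷ (step a p) = reverseʷ p ∷ʳʷ Adj-sym a

  Within : ℕ → V → V → Set
  Within d u v = Σ ℕ λ n → Walk u v n × n ≤ d

  reverse-within : ∀ {d u v} → Within d u v → Within d v u
  reverse-within (n , p , n≤d) = n , reverseʷ p , n≤d

  isometric-length≤ : ∀ {d} → (∀ u v → Within d u v) →
                      ∀ P → IsIsometricPath P → length (toList P) ≤ suc d
  isometric-length≤ diameter (x ∷ xs) (_ , _ , minimal) with diameter x (List⁺.last (x ∷ xs))
  ... | n , p , n≤d = s≤s (≤-trans (minimal n p) n≤d)

  cover-lower-bound : ∀ {n m d} → Fin n ↣ V → (∀ u v → Within d u v) →
                      HasIsoPathCover m → n ≤ m * suc d
  cover-lower-bound Fin-n↣V diameter (P , isometric , cover) =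
    cover-by-short-lists⇒≤ Fin-n↣V (toList ∘ P)
      (λ i → isometric-length≤ diameter (P i) (isometric i)) cover

  partition⇒cover : ∀ {m} → HasIsoPathPartition m → HasIsoPathCover m
  partition⇒cover (P , isometric , partition) =
    P , isometric , λ v → proj₁ (partition v) , proj₁ (proj₂ (partition v))

2^n↔Vec-Bool : ∀ n → Fin (2 ^ n) ↔ Vec Bool n
2^n↔Vec-Bool n = mk↔ₛ′ (toBits n) fromBits toBits-fromBits (fromBits-toBits n)
  where
  open Inverse 2↔Bool using (to; from; strictlyInverseˡ; strictlyInverseʳ)

  toBits : ∀ n → Fin (2 ^ n) → Vec Bool n
  toBits zero    _ = []
  toBits (suc n) k = to (proj₁ (remQuot (2 ^ n) k)) ∷ toBits n (proj₂ (remQuot (2 ^ n) k))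

  fromBits : ∀ {n} → Vec Bool n → Fin (2 ^ n)
  fromBits []      = fzero
  fromBits (b ∷ w) = combine (from b) (fromBits w)

  toBits-fromBits : ∀ {n} (w : Vec Bool n) → toBits n (fromBits w) ≡ w
  toBits-fromBits []      = refl
  toBits-fromBits {suc n} (b ∷ w) = begin
    toBits (suc n) (combine (from b) (fromBits w))
      ≡⟨ cong (λ (c , k) → to c ∷ toBits n k) (remQuot-combine (from b) (fromBits w)) ⟩
    to (from b) ∷ toBits n (fromBits w)
      ≡⟨ cong₂ _∷_ (strictlyInverseˡ b) (toBits-fromBits w) ⟩
    b ∷ w ∎
    where open ≡-Reasoning

  fromBits-toBits : ∀ n (k : Fin (2 ^ n)) → fromBits (toBits n k) ≡ k
  fromBits-toBits zero    fzero = refl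
  fromBits-toBits (suc n) k = begin
    combine (from (to c)) (fromBits (toBits n k′))
      ≡⟨ cong₂ combine (strictlyInverseʳ c) (fromBits-toBits n k′) ⟩
    combine c k′
      ≡⟨ combine-remQuot (2 ^ n) k ⟩
    k ∎
    where
    open ≡-Reasoning
    c = proj₁ (remQuot (2 ^ n) k)
    k′ = proj₂ (remQuot (2 ^ n) k)

2*n≡n+n : ∀ n → 2 * n ≡ n + n
2*n≡n+n n = cong (n +_) (+-identityʳ n)

-- Bit q is used between levels t and t + 1 of the upper butterfly for t = 2r − 1 − q.
mirror-level : ∀ {q r} → q < r → Σ ℕ λ t → r ≤ t × t < 2 * r × 2 * r ∸ suc t ≡ q
mirror-level {q} {r} q<r with m≤n⇒∃[o]m+o≡n q<r
... | s , refl = r + s , m≤m+n r s , r+s<2r , mirror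
  where
  open ≡-Reasoning
  r+s<2r : r + s < 2 * r
  r+s<2r = subst (r + s <_) (sym (2*n≡n+n r)) (+-monoʳ-< r (m<n+m s z<s))
  mirror : 2 * r ∸ suc (r + s) ≡ q
  mirror = begin
    2 * r ∸ suc (r + s)        ≡⟨ cong₂ _∸_ (2*n≡n+n r) (sym (+-suc r s)) ⟩
    (r + r) ∸ (r + suc s)      ≡⟨ [m+n]∸[m+o]≡n∸o r r (suc s) ⟩
    suc q + s ∸ suc s          ≡⟨ cong (_∸ suc s) (+-suc q s) ⟨
    q + suc s ∸ suc s          ≡⟨ m+n∸n≡m q (suc s) ⟩
    q                          ∎

lower-route-bound : ∀ {r i j} → i ≤ j → j ≤ r → ∣ i - 0 ∣ + (r + ∣ r - j ∣) ≤ 2 * r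
lower-route-bound {r} {i} {j} i≤j j≤r = begin
  ∣ i - 0 ∣ + (r + ∣ r - j ∣)  ≡⟨ cong₂ (λ a b → a + (r + b)) (∣-∣-identityʳ i) (m≤n⇒∣n-m∣≡n∸m j≤r) ⟩
  i + (r + (r ∸ j))            ≤⟨ +-monoˡ-≤ _ i≤j ⟩
  j + (r + (r ∸ j))            ≡⟨ x∙yz≈y∙xz j r (r ∸ j) ⟩
  r + (j + (r ∸ j))            ≡⟨ cong (r +_) (m+[n∸m]≡n j≤r) ⟩
  r + r                        ≡⟨ 2*n≡n+n r ⟨
  2 * r                        ∎
  where open ≤-Reasoning

upper-route-bound : ∀ {r i j} → i ≤ j → r ≤ i → j ≤ 2 * r →
                    ∣ i - r ∣ + (r + ∣ 2 * r - j ∣) ≤ 2 * r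
upper-route-bound {r} {i} {j} i≤j r≤i j≤2r = begin
  ∣ i - r ∣ + (r + ∣ 2 * r - j ∣)
    ≡⟨ cong₂ (λ a b → a + (r + b)) (m≤n⇒∣n-m∣≡n∸m r≤i) (m≤n⇒∣n-m∣≡n∸m j≤2r) ⟩
  (i ∸ r) + (r + (2 * r ∸ j))      ≡⟨ +-assoc (i ∸ r) r _ ⟨
  (i ∸ r + r) + (2 * r ∸ j)        ≡⟨ cong (_+ (2 * r ∸ j)) (m∸n+n≡m r≤i) ⟩
  i + (2 * r ∸ j)                  ≤⟨ +-monoˡ-≤ _ i≤j ⟩
  j + (2 * r ∸ j)                  ≡⟨ m+[n∸m]≡n j≤2r ⟩
  2 * r                            ∎
  where open ≤-Reasoning

-- When i ≤ r ≤ j the two routes have lengths i + j and 4r − (i + j).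
crossing-route-bound : ∀ {r i j} → i ≤ r → r ≤ j → j ≤ 2 * r →
  ∣ i - 0 ∣ + (r + ∣ r - j ∣) ≤ 2 * r ⊎ ∣ i - r ∣ + (r + ∣ 2 * r - j ∣) ≤ 2 * r
crossing-route-bound {r} {i} {j} i≤r r≤j j≤2r with i + j ≤? 2 * r
... | yes i+j≤2r = inj₁ (≤-trans (≤-reflexive lower≡i+j) i+j≤2r)
  where
  lower≡i+j : ∣ i - 0 ∣ + (r + ∣ r - j ∣) ≡ i + j
  lower≡i+j = trans (cong₂ (λ a b → a + (r + b)) (∣-∣-identityʳ i) (m≤n⇒∣m-n∣≡n∸m r≤j))
                    (cong (i +_) (m+[n∸m]≡n r≤j))
... | no i+j≰2r = inj₂ (+-cancelʳ-≤ (i + j) _ _ (begin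
  ∣ i - r ∣ + (r + ∣ 2 * r - j ∣) + (i + j)
    ≡⟨ cong₂ (λ a b → a + (r + b) + (i + j)) (m≤n⇒∣m-n∣≡n∸m i≤r) (m≤n⇒∣n-m∣≡n∸m j≤2r) ⟩
  (r ∸ i) + (r + (2 * r ∸ j)) + (i + j)
    ≡⟨ interchange (r ∸ i) (r + (2 * r ∸ j)) i j ⟩
  (r ∸ i + i) + (r + (2 * r ∸ j) + j)
    ≡⟨ cong₂ _+_ (m∸n+n≡m i≤r) (trans (+-assoc r _ j) (cong (r +_) (m∸n+n≡m j≤2r))) ⟩
  r + (r + 2 * r)
    ≡⟨ +-assoc r r (2 * r) ⟨
  (r + r) + 2 * r
    ≡⟨ cong (_+ 2 * r) (2*n≡n+n r) ⟨
  2 * r + 2 * r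
    ≤⟨ +-monoʳ-≤ (2 * r) (<⇒≤ (≰⇒> i+j≰2r)) ⟩
  2 * r + (i + j)
    ∎))
  where open ≤-Reasoning

route-bound : ∀ {r i j} → i ≤ j → j ≤ 2 * r →
  ∣ i - 0 ∣ + (r + ∣ r - j ∣) ≤ 2 * r ⊎ ∣ i - r ∣ + (r + ∣ 2 * r - j ∣) ≤ 2 * r
route-bound {r} {i} {j} i≤j j≤2r with ≤-total j r | ≤-total r i
... | inj₁ j≤r | _        = inj₁ (lower-route-bound i≤j j≤r)
... | inj₂ r≤j | inj₁ r≤i = inj₂ (upper-route-bound i≤j r≤i j≤2r)
... | inj₂ r≤j | inj₂ i≤r = crossing-route-bound i≤r r≤j j≤2r

BNAdj-sym : ∀ r → Symmetric (BNAdj r)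
BNAdj-sym r (inj₁ e) = inj₂ e
BNAdj-sym r (inj₂ e) = inj₁ e

lookup-ext : ∀ {A : Set} {n} {x y : Vec A n} → (∀ q → lookup x q ≡ lookup y q) → x ≡ y
lookup-ext {x = x} {y} eq = trans (sym (tabulate∘lookup x)) (trans (tabulate-cong eq) (tabulate∘lookup y))

bitPos-low : ∀ {r t} → t < r → bitPos r t ≡ t
bitPos-low {r} {t} t<r with t <? r
... | yes _   = refl
... | no  t≮r = contradiction t<r t≮r

bitPos-high : ∀ {r t} → r ≤ t → bitPos r t ≡ 2 * r ∸ suc t
bitPos-high {r} {t} r≤t with t <? r
... | yes t<r = contradiction r≤t (<⇒≱ t<r)
... | no  _   = refl

module Benes (r : ℕ) where
  open GraphNotions (BNVertex r) (BNAdj r)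
  open WalkProperties (BNVertex r) (BNAdj r) (BNAdj-sym r)

  Level : Set
  Level = Fin (suc (2 * r))

  bottom mid top : Level
  bottom = fzero
  mid    = fromℕ< (s≤s (m≤m+n r (r + 0)))
  top    = fromℕ (2 * r)

  toℕ-mid : toℕ mid ≡ r
  toℕ-mid = toℕ-fromℕ< (s≤s (m≤m+n r (r + 0)))

  toℕ-top : toℕ top ≡ 2 * r
  toℕ-top = toℕ-fromℕ (2 * r)

  level : BNVertex r → ℕ
  level = toℕ ∘ proj₂

  adj-level≤ : ∀ {u v} → BNAdj r u v → level v ≤ suc (level u)
  adj-level≤ (inj₁ (up , _))   = ≤-reflexive up
  adj-level≤ (inj₂ (down , _)) = ≤-trans (n≤1+n _) (≤-trans (≤-reflexive (sym down)) (n≤1+n _))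

  walk-level≤ : ∀ {u v n} → Walk u v n → level v ≤ level u + n
  walk-level≤ {u} here = ≤-reflexive (sym (+-identityʳ (level u)))
  walk-level≤ {u} {n = suc n} (step a p) = begin
    _                   ≤⟨ walk-level≤ p ⟩
    _ + n               ≤⟨ +-monoˡ-≤ n (adj-level≤ a) ⟩
    suc (level u) + n   ≡⟨ +-suc (level u) n ⟨
    level u + suc n     ∎
    where open ≤-Reasoning

  UsedBetween : ℕ → ℕ → Fin r → Set
  UsedBetween a b q = Σ ℕ λ t → a ≤ t × t < b × bitPos r t ≡ toℕ q

  UsedBetween-split : ∀ {a b q} → UsedBetween a b q → UsedBetween (suc a) b q ⊎ bitPos r a ≡ toℕ q
  UsedBetween-split (t , a≤t , t<b , used) with m≤n⇒m<n∨m≡n a≤t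
  ... | inj₁ a<t  = inj₁ (t , a<t , t<b , used)
  ... | inj₂ refl = inj₂ used

  UsedBetween-empty : ∀ {a b q} → a ≡ b → ¬ UsedBetween a b q
  UsedBetween-empty a≡b (_ , a≤t , t<b , _) = <-irrefl a≡b (≤-<-trans a≤t t<b)

  AgreeOff : ℕ → ℕ → Vec Bool r → Vec Bool r → Set
  AgreeOff a b x y = ∀ q → ¬ UsedBetween a b q → lookup x q ≡ lookup y q

  AgreeExcept : ℕ → Vec Bool r → Vec Bool r → Set
  AgreeExcept p x y = ∀ q → toℕ q ≢ p → lookup x q ≡ lookup y q

  agreeExcept⇒≡⊎DiffExactlyAt : ∀ {p x y} → AgreeExcept p x y → x ≡ y ⊎ DiffExactlyAt x y p
  agreeExcept⇒≡⊎DiffExactlyAt {p} {x} {y} agree with ≡-dec Data.Bool._≟_ x y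
  ... | yes x≡y = inj₁ x≡y
  ... | no  x≢y = inj₂ λ q → (λ q≡p x≡y-at-q → x≢y (agree-at q≡p x≡y-at-q)) , agree q
    where
    agree-at : ∀ {q} → toℕ q ≡ p → lookup x q ≡ lookup y q → x ≡ y
    agree-at {q} q≡p x≡y-at-q = lookup-ext λ q′ → agree-at-q′ q′ (toℕ q′ ≟ p)
      where
      agree-at-q′ : ∀ q′ → Dec (toℕ q′ ≡ p) → lookup x q′ ≡ lookup y q′
      agree-at-q′ q′ (yes q′≡p) rewrite toℕ-injective (trans q′≡p (sym q≡p)) = x≡y-at-q
      agree-at-q′ q′ (no  q′≢p) = agree q′ q′≢p

  copyBit : ℕ → Vec Bool r → Vec Bool r → Vec Bool r
  copyBit p x y = tabulate λ q → if does (toℕ q ≟ p) then lookup y q else lookup x q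

  copyBit-at : ∀ {p x y q} → toℕ q ≡ p → lookup (copyBit p x y) q ≡ lookup y q
  copyBit-at {p} {x} {y} {q} q≡p =
    trans (lookup∘tabulate _ q) (cong (if_then lookup y q else lookup x q) (dec-true (toℕ q ≟ p) q≡p))

  copyBit-off : ∀ {p x y q} → toℕ q ≢ p → lookup (copyBit p x y) q ≡ lookup x q
  copyBit-off {p} {x} {y} {q} q≢p =
    trans (lookup∘tabulate _ q) (cong (if_then lookup y q else lookup x q) (dec-false (toℕ q ≟ p) q≢p))

  -- Each upward edge from a level t may set bit bitPos r t to its value in y.
  climb : ∀ d {x y} (i j : Level) → d + toℕ i ≡ toℕ j → AgreeOff (toℕ i) (toℕ j) x y →
          Walk (x , i) (y , j) d
  climb zero {x} {y} i j i≡j agree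
    with toℕ-injective i≡j | lookup-ext {x = x} {y} (λ q → agree q (UsedBetween-empty i≡j))
  ... | refl | refl = here
  climb (suc d) {x} {y} i j d+1+i≡j agree = step first-edge (climb d i′ j d+i′≡j agree′)
    where
    p : ℕ
    p = bitPos r (toℕ i)

    z : Vec Bool r
    z = copyBit p x y

    i+1< : suc (toℕ i) < suc (2 * r)
    i+1< = ≤-trans (s≤s (subst (toℕ i <_) d+1+i≡j (s≤s (m≤n+m (toℕ i) d)))) (toℕ<n j)

    i′ : Level
    i′ = fromℕ< i+1<

    first-edge : BNAdj r (x , i) (z , i′)
    first-edge = inj₁ (toℕ-fromℕ< i+1< ,
                       agreeExcept⇒≡⊎DiffExactlyAt λ q q≢p → sym (copyBit-off {x = x} {y} q≢p))

    d+i′≡j : d + toℕ i′ ≡ toℕ j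
    d+i′≡j = trans (cong (d +_) (toℕ-fromℕ< i+1<)) (trans (+-suc d (toℕ i)) d+1+i≡j)

    agree′ : AgreeOff (toℕ i′) (toℕ j) z y
    agree′ q unused with toℕ q ≟ p
    ... | yes q≡p = copyBit-at {x = x} {y} q≡p
    ... | no  q≢p = trans (copyBit-off {x = x} {y} q≢p) (agree q λ used →
                      [ unused ∘ subst (λ a → UsedBetween a (toℕ j) q) (sym (toℕ-fromℕ< i+1<)) , q≢p ∘ sym ]′
                        (UsedBetween-split used))

  vertical : ∀ w (i j : Level) → Walk (w , i) (w , j) ∣ toℕ i - toℕ j ∣
  vertical w i j with ≤-total (toℕ i) (toℕ j)
  ... | inj₁ i≤j = subst (Walk (w , i) (w , j)) (sym (m≤n⇒∣m-n∣≡n∸m i≤j))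
                     (climb _ i j (m∸n+n≡m i≤j) (λ _ _ → refl))
  ... | inj₂ j≤i = subst (Walk (w , i) (w , j)) (sym (m≤n⇒∣n-m∣≡n∸m j≤i))
                     (reverseʷ (climb _ j i (m∸n+n≡m j≤i) (λ _ _ → refl)))

  sweep : ∀ (s t : Level) → r + toℕ s ≡ toℕ t → (∀ q → UsedBetween (toℕ s) (toℕ t) q) →
          ∀ x y → Walk (x , s) (y , t) r
  sweep s t r+s≡t all-used x y = climb r s t r+s≡t λ q unused → contradiction (all-used q) unused

  lower-sweep : ∀ x y → Walk (x , bottom) (y , mid) r
  lower-sweep = sweep bottom mid (trans (+-identityʳ r) (sym toℕ-mid)) lower-used
    where
    lower-used : ∀ q → UsedBetween 0 (toℕ mid) q
    lower-used q rewrite toℕ-mid = toℕ q , z≤n , toℕ<n q , bitPos-low (toℕ<n q)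

  upper-sweep : ∀ x y → Walk (x , mid) (y , top) r
  upper-sweep =
    sweep mid top (trans (cong (r +_) toℕ-mid) (trans (sym (2*n≡n+n r)) (sym toℕ-top))) upper-used
    where
    upper-used : ∀ q → UsedBetween (toℕ mid) (toℕ top) q
    upper-used q rewrite toℕ-mid | toℕ-top with mirror-level (toℕ<n q)
    ... | t , r≤t , t<2r , mirror = t , r≤t , t<2r , trans (bitPos-high r≤t) mirror

  route-within : ∀ {s t : Level} {a b} → (∀ x y → Walk (x , s) (y , t) r) →
                 toℕ s ≡ a → toℕ t ≡ b →
                 ∀ {w w′} i j → ∣ toℕ i - a ∣ + (r + ∣ b - toℕ j ∣) ≤ 2 * r →
                 Within (2 * r) (w , i) (w′ , j)
  route-within {s} {t} through refl refl {w} {w′} i j short =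
    _ , vertical w i s ++ʷ (through w w′ ++ʷ vertical w′ t j) , short

  diameter-ordered : ∀ {w w′} (i j : Level) → toℕ i ≤ toℕ j → Within (2 * r) (w , i) (w′ , j)
  diameter-ordered i j i≤j with route-bound {r} i≤j (≤-pred (toℕ<n j))
  ... | inj₁ short = route-within lower-sweep refl toℕ-mid i j short
  ... | inj₂ short = route-within upper-sweep toℕ-mid toℕ-top i j short

  diameter : ∀ u v → Within (2 * r) u v
  diameter (_ , i) (_ , j) with ≤-total (toℕ i) (toℕ j)
  ... | inj₁ i≤j = diameter-ordered i j i≤j
  ... | inj₂ j≤i = reverse-within (diameter-ordered j i j≤i)

  line : Vec Bool r → List⁺ (BNVertex r)
  line w = (w , fzero) ∷ List.tabulate (λ l → w , fsuc l)

  line-isometric : ∀ w → IsIsometricPath (line w)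
  line-isometric w = (tabulate⁺ {f = w ,_} (cong proj₂) , linked-tabulate (2 * r) (w ,_) up-edge) , distance
    where
    up-edge : ∀ l → BNAdj r (w , inject₁ l) (w , fsuc l)
    up-edge l = inj₁ (cong suc (sym (toℕ-inject₁ l)) , inj₁ refl)

    distance : IsDist (w , fzero) (List⁺.last (line w)) (pathLength (line w))
    distance rewrite last-tabulate (2 * r) (w ,_) =
      subst (Walk _ _) top≡length (vertical w bottom top) ,
      λ n p → subst (_≤ n) top≡length (walk-level≤ p)
      where
      top≡length : toℕ top ≡ pathLength (line w)
      top≡length = trans toℕ-top (sym (length-tabulate (λ l → w , fsuc l)))

  open Inverse (2^n↔Vec-Bool r) using (strictlyInverseˡ; strictlyInverseʳ)
    renaming (to to toBits; from to fromBits)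

  lines : Fin (2 ^ r) → List⁺ (BNVertex r)
  lines = line ∘ toBits

  ∈-lines : ∀ w l → (w , l) ∈ toList (lines (fromBits w))
  ∈-lines w l rewrite strictlyInverseˡ w = ∈-tabulate⁺ {f = w ,_} l

  ∈-lines⇒≡fromBits : ∀ {w l} k → (w , l) ∈ toList (lines k) → k ≡ fromBits w
  ∈-lines⇒≡fromBits k w,l∈ with ∈-tabulate⁻ {f = toBits k ,_} w,l∈
  ... | _ , refl = sym (strictlyInverseʳ k)

  lines-partition : HasIsoPathPartition (2 ^ r)
  lines-partition =
    lines , line-isometric ∘ toBits , λ (w , l) → fromBits w , ∈-lines w l , λ k → ∈-lines⇒≡fromBits {w} {l} k

  vertices↔ : Fin (2 ^ r * suc (2 * r)) ↔ BNVertex r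
  vertices↔ = (2^n↔Vec-Bool r ×-↔ ↔-id _) ↔-∘ *↔×

  isoPathCover⇒2^r≤ : ∀ m → HasIsoPathCover m → 2 ^ r ≤ m
  isoPathCover⇒2^r≤ m cover =
    *-cancelʳ-≤ (2 ^ r) m (suc (2 * r)) (cover-lower-bound (↔⇒↣ vertices↔) diameter cover)

theorem9 : ∀ (r : ℕ) → 1 ≤ r →
    GraphNotions.IpCoverIs (BNVertex r) (BNAdj r) (2 ^ r) ×
    GraphNotions.IpPartitionIs (BNVertex r) (BNAdj r) (2 ^ r)
theorem9 r _ = (partition⇒cover lines-partition , isoPathCover⇒2^r≤)
             , (lines-partition , λ m → isoPathCover⇒2^r≤ m ∘ partition⇒cover)
  where
  open Benes r
  open WalkProperties (BNVertex r) (BNAdj r) (BNAdj-sym r)
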